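{- Let $g:\mathbb{N}\to\mathbb{C}$ be the Gutman–Ivić–Matula function, i.e. the unique completely additive function (so $g(1)=0$ and $g(ab)=g(a)+g(b)$ for all $a,b\in\mathbb{N}$) such that $g(p(n))=1+g(n)$ for every $n\in\mathbb{N}$, where $p(n)$ denotes the $n$-th prime in ascending order. Let $M_{\mathbb{P}}=\sum_{p\in\mathbb{P}}4^{ -g(p)}$, where $\mathbb{P}$ is the set of primes. Then $$M_{\mathbb{N}}=\sum_{n\in\mathbb{N}}\frac{1}{4^{g(n)}}=4M_{\mathbb{P}}<2.$$
   Context: $\mathbb{N}=\{1,2,3,\dots\}$; $p(n)$ is the $n$-th prime ($p(1)=2$, $p(2)=3$, \dots); $\mathbb{P}$ is the set of primes. -}

module Defs where

open import Data.Nat as ℕ using (ℕ; zero; suc)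
open import Data.Nat.Primality using (Prime; prime?)
open import Data.List using (List; []; _∷_; filter; map; sum; length)
open import Data.Integer using (+_)
open import Data.Rational using (ℚ; _/_; _+_; _*_; 0ℚ; 1ℚ; _≤_)
open import Data.Product using (Σ; _×_; ∃)

range1 : ℕ → List ℕ
range1 zero    = []
range1 (suc n) = range1 n Data.List.++ (suc n ∷ [])

-- primeCount q = π(q) = #{primes ≤ q}.  The q-th... : q = p(n) iff Prime q and primeCount q ≡ n.
primeCount : ℕ → ℕ
primeCount q = length (filter prime? (range1 q))

quarterPow : ℕ → ℚ
quarterPow zero    = 1ℚ
quarterPow (suc k) = (+ 1 / 4) * quarterPow k

sumℚ : List ℚ → ℚ
sumℚ []       = 0ℚ
sumℚ (x ∷ xs) = x + sumℚ xs

partialℕ : (ℕ → ℕ) → ℕ → ℚ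
partialℕ g N = sumℚ (map (λ n → quarterPow (g n)) (range1 N))

partialℙ : (ℕ → ℕ) → ℕ → ℚ
partialℙ g N = sumℚ (map (λ n → quarterPow (g n)) (filter prime? (range1 N)))

-- two nondecreasing sequences of nonnegative rationals have the same supremum
-- (in [0,∞]): each term of one is, up to any ε > 0, bounded by some term of the other.
SameSup : (ℕ → ℚ) → (ℕ → ℚ) → Set
SameSup a b =
  ((N : ℕ) (ε : ℚ) → 0ℚ Data.Rational.< ε → ∃ λ K → a N ≤ b K + ε) ×
  ((N : ℕ) (ε : ℚ) → 0ℚ Data.Rational.< ε → ∃ λ K → b N ≤ a K + ε)

-- Every n ≥ 2 is 2k, or qr with q an odd prime and r odd.  Complete additivity and g(p(m)) = 1 + g(m)
-- give 4^{-g(2k)} = 4^{-g(k)}/4 and 4^{-g(qr)} = 4^{-g(π q)} 4^{-g(r)}/4, and n is recovered from k,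
-- resp. from (π q, r).  Hence S(N) = Σ_{n ≤ N} 4^{-g(n)} and its odd part O(N) satisfy
-- S(N+1) ≤ 1 + (S(N) + A(N) O(N))/4 and O(N+1) ≤ 1 + A(N) O(N)/4, where A(N) = S(N) − 1 is the sum
-- over 2 ≤ n ≤ N; induction gives S ≤ 7/4 < 2 and O ≤ 5/4.  Since π(p) − 1 = π(p − 1) for a prime p,
-- g(p) = 1 + g(π p) turns 4 Σ_{p ≤ K} 4^{-g(p)} into S(π K), and π is unbounded, so both series
-- have the same sum.
module Submission where

open import Defs
open import Data.Nat using (ℕ; suc; _≤_)
open import Data.Nat.Primality using (Prime)
open import Relation.Binary.PropositionalEquality using (_≡_)
open import Data.Product using (_×_; ∃)
open import Data.Integer using (+_)
open import Data.Rational using (ℚ; _/_; _*_; _<_)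

open import Data.Nat as ℕ using (zero; z≤n; s≤s)
import Data.Nat.Properties as ℕ
open import Data.Nat.Divisibility
  using (_∣_; _∣?_; divides; ∣-trans; ∣1⇒≡1; m∣m*n; ∣m⇒∣m*n; ∣n⇒∣m*n; ∣m+n∣m⇒∣n; m≤n⇒m!∣n!)
open import Data.Nat.ListAction using (product)
open import Data.Nat.Primality using (prime?; prime[2]; ¬prime[0]; ¬prime[1]; prime⇒nonZero)
open import Data.Nat.Primality.Factorisation using (factorise)
open import Data.Rational as ℚ using (0ℚ; 1ℚ)
import Data.Rational.Properties as ℚ
open import Data.Rational.Solver using (module +-*-Solver)
open import Data.List using (List; []; _∷_; _++_; _∷ʳ_; map; filter; length; applyUpTo; cartesianProductWith)
open import Data.List.Properties
  using (map-++; filter-++; filter-accept; filter-reject; ++-identityʳ; applyUpTo-∷ʳ; length-++)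
import Data.List.Relation.Unary.All as All
open import Data.List.Relation.Unary.AllPairs using (_∷_)
open import Data.List.Relation.Unary.Any using (here; there)
open import Data.List.Relation.Unary.Unique.Propositional using (Unique)
import Data.List.Relation.Unary.Unique.Propositional.Properties as Unique
open import Data.List.Membership.Propositional using (_∈_)
open import Data.List.Membership.Propositional.Properties
  using ( ∈-∃++; ∈-++⁺ˡ; ∈-++⁺ʳ; ∈-++⁻; ∈-map⁺; ∈-map⁻; ∈-filter⁺; ∈-filter⁻
        ; ∈-applyUpTo⁺; ∈-applyUpTo⁻; ∈-cartesianProductWith⁺)
open import Data.List.Relation.Binary.Subset.Propositional using (_⊆_)
open import Data.Product using (_,_; proj₁; proj₂; ∃₂)
open import Data.Sum using (inj₁; inj₂)
open import Data.Empty using (⊥-elim)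
open import Function using (_∘_)
open import Relation.Unary using (Decidable)
open import Relation.Binary using (tri<; tri≈; tri>)
open import Relation.Nullary using (¬_; ¬?; Dec; yes; no)
open import Relation.Nullary.Decidable using (from-yes)
open import Relation.Binary.PropositionalEquality
  using (_≢_; refl; sym; trans; cong; cong₂; subst; module ≡-Reasoning)

private
  variable
    A B C : Set

range1≡applyUpTo : ∀ n → range1 n ≡ applyUpTo suc n
range1≡applyUpTo zero    = refl
range1≡applyUpTo (suc n) = trans (cong (_∷ʳ suc n) (range1≡applyUpTo n)) (applyUpTo-∷ʳ suc n)

∈-range1⁺ : ∀ {x n} → 1 ≤ x → x ≤ n → x ∈ range1 n
∈-range1⁺ {suc i} {n} _ x≤n rewrite range1≡applyUpTo n = ∈-applyUpTo⁺ suc x≤n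

∈-range1⁻ : ∀ {x} n → x ∈ range1 n → 1 ≤ x × x ≤ n
∈-range1⁻ n x∈ rewrite range1≡applyUpTo n with ∈-applyUpTo⁻ suc x∈
... | i , i<n , refl = s≤s z≤n , i<n

range1-unique : ∀ n → Unique (range1 n)
range1-unique n rewrite range1≡applyUpTo n =
  Unique.applyUpTo⁺₁ suc n (λ i<j _ → ℕ.<⇒≢ (s≤s i<j))

range1-⊆ : ∀ {m n} → m ≤ n → range1 m ⊆ range1 n
range1-⊆ {m} m≤n x∈ with ∈-range1⁻ m x∈
... | 1≤x , x≤m = ∈-range1⁺ 1≤x (ℕ.≤-trans x≤m m≤n)

module _ {P : A → Set} (P? : Decidable P) where

  filter-∷ʳ-accept : ∀ {x} xs → P x → filter P? (xs ∷ʳ x) ≡ filter P? xs ∷ʳ x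
  filter-∷ʳ-accept {x} xs px = trans (filter-++ P? xs (x ∷ [])) (cong (filter P? xs ++_) (filter-accept P? px))

  filter-∷ʳ-reject : ∀ {x} xs → ¬ P x → filter P? (xs ∷ʳ x) ≡ filter P? xs
  filter-∷ʳ-reject {x} xs ¬px =
    trans (filter-++ P? xs (x ∷ [])) (trans (cong (filter P? xs ++_) (filter-reject P? ¬px)) (++-identityʳ _))

m<n*m : ∀ m {n} → .{{_ : ℕ.NonZero m}} → 1 ℕ.< n → m ℕ.< n ℕ.* m
m<n*m m {n} 1<n = subst (m ℕ.<_) (ℕ.*-comm m n) (ℕ.m<m*n m n 1<n)

Odd : ℕ → Set
Odd n = ¬ 2 ∣ n

odd? : ∀ n → Dec (Odd n)
odd? n = ¬? (2 ∣? n)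

oddPrime⇒3≤ : ∀ {q} → Prime q → Odd q → 3 ≤ q
oddPrime⇒3≤ {0}                 q-prime _     = ⊥-elim (¬prime[0] q-prime)
oddPrime⇒3≤ {1}                 q-prime _     = ⊥-elim (¬prime[1] q-prime)
oddPrime⇒3≤ {2}                 _       q-odd = ⊥-elim (q-odd (divides 1 refl))
oddPrime⇒3≤ {suc (suc (suc _))} _       _     = s≤s (s≤s (s≤s z≤n))

primeFactor : ∀ n → .{{_ : ℕ.NonZero n}} → n ≢ 1 → ∃₂ λ p r → Prime p × n ≡ p ℕ.* r
primeFactor n n≢1 with factorise n
... | record { factors = [] ; isFactorisation = n≡1 } = ⊥-elim (n≢1 n≡1)
... | record { factors = p ∷ ps ; isFactorisation = n≡p*Πps ; factorsPrime = p-prime All.∷ _ } =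
  p , product ps , p-prime , n≡p*Πps

prime⇒1≤ : ∀ {p} → Prime p → 1 ≤ p
prime⇒1≤ {p} p-prime = ℕ.>-nonZero⁻¹ p ⦃ prime⇒nonZero p-prime ⦄

m≤n⇒m∣n! : ∀ {m n} → 1 ≤ m → m ≤ n → m ∣ n ℕ.!
m≤n⇒m∣n! {suc m} _ m≤n = ∣-trans (m∣m*n (m ℕ.!)) (m≤n⇒m!∣n! m≤n)

prime-above : ∀ K → ∃ λ p → Prime p × K ℕ.< p
prime-above K with primeFactor (suc (K ℕ.!)) (λ eq → ℕ.<⇒≢ (ℕ.1≤n! K) (sym (ℕ.suc-injective eq)))
... | p , r , p-prime , eq with K ℕ.<? p
...   | yes K<p = p , p-prime , K<p
...   | no  K≮p = ⊥-elim (¬prime[1] (subst Prime (∣1⇒≡1 p∣1) p-prime))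
  where
  p∣K!+1 : p ∣ K ℕ.! ℕ.+ 1
  p∣K!+1 = divides r (trans (ℕ.+-comm (K ℕ.!) 1) (trans eq (ℕ.*-comm p r)))
  p∣1 : p ∣ 1
  p∣1 = ∣m+n∣m⇒∣n p∣K!+1 (m≤n⇒m∣n! (prime⇒1≤ p-prime) (ℕ.≮⇒≥ K≮p))

primeCount-suc-prime : ∀ n → Prime (suc n) → primeCount (suc n) ≡ suc (primeCount n)
primeCount-suc-prime n p = begin
  length (filter prime? (range1 n ∷ʳ suc n))  ≡⟨ cong length (filter-∷ʳ-accept prime? (range1 n) p) ⟩
  length (filter prime? (range1 n) ∷ʳ suc n)  ≡⟨ length-++ (filter prime? (range1 n)) ⟩
  primeCount n ℕ.+ 1                          ≡⟨ ℕ.+-comm (primeCount n) 1 ⟩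
  suc (primeCount n)                          ∎
  where open ≡-Reasoning

primeCount-suc-nonprime : ∀ n → ¬ Prime (suc n) → primeCount (suc n) ≡ primeCount n
primeCount-suc-nonprime n ¬p = cong length (filter-∷ʳ-reject prime? (range1 n) ¬p)

primeCount-≤-suc : ∀ n → primeCount n ≤ primeCount (suc n)
primeCount-≤-suc n with prime? (suc n)
... | yes p rewrite primeCount-suc-prime n p     = ℕ.n≤1+n (primeCount n)
... | no ¬p rewrite primeCount-suc-nonprime n ¬p = ℕ.≤-refl

primeCount-suc-≤ : ∀ n → primeCount (suc n) ≤ suc (primeCount n)
primeCount-suc-≤ n with prime? (suc n)
... | yes p rewrite primeCount-suc-prime n p     = ℕ.≤-refl
... | no ¬p rewrite primeCount-suc-nonprime n ¬p = ℕ.n≤1+n (primeCount n)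

primeCount-mono-≤ : ∀ {m n} → m ≤ n → primeCount m ≤ primeCount n
primeCount-mono-≤ {m} m≤n = go (ℕ.≤⇒≤′ m≤n)
  where
  go : ∀ {n} → m ℕ.≤′ n → primeCount m ≤ primeCount n
  go ℕ.≤′-refl                = ℕ.≤-refl
  go {suc n} (ℕ.≤′-step m≤′n) = ℕ.≤-trans (go m≤′n) (primeCount-≤-suc n)

primeCount-< : ∀ {n} → 1 ≤ n → primeCount n ℕ.< n
primeCount-< {suc zero}    _ = s≤s z≤n
primeCount-< {suc (suc n)} _ = s≤s (ℕ.≤-trans (primeCount-suc-≤ (suc n)) (primeCount-< {suc n} (s≤s z≤n)))

primeCount-prime : ∀ {q} → Prime q → primeCount q ≡ suc (primeCount (ℕ.pred q))
primeCount-prime {suc q} p = primeCount-suc-prime q p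

primeCount-<-prime : ∀ {m q} → m ℕ.< q → Prime q → primeCount m ℕ.< primeCount q
primeCount-<-prime {q = suc q} (s≤s m≤q) p rewrite primeCount-suc-prime q p = s≤s (primeCount-mono-≤ m≤q)

primeCount-injective : ∀ {q q′} → Prime q → Prime q′ → primeCount q ≡ primeCount q′ → q ≡ q′
primeCount-injective {q} {q′} p p′ eq with ℕ.<-cmp q q′
... | tri< q<q′ _ _ = ⊥-elim (ℕ.<-irrefl eq (primeCount-<-prime q<q′ p′))
... | tri≈ _ q≡q′ _ = q≡q′
... | tri> _ _ q>q′ = ⊥-elim (ℕ.<-irrefl (sym eq) (primeCount-<-prime q>q′ p))

primeCount-unbounded : ∀ N → ∃ λ K → N ≤ primeCount K
primeCount-unbounded zero = 0 , z≤n
primeCount-unbounded (suc N) with primeCount-unbounded N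
... | K , N≤πK with prime-above K
...   | p , p-prime , K<p = p , ℕ.≤-trans (s≤s N≤πK) (primeCount-<-prime K<p p-prime)

*-nonNeg : ∀ {p q} → 0ℚ ℚ.≤ p → 0ℚ ℚ.≤ q → 0ℚ ℚ.≤ p ℚ.* q
*-nonNeg {p} {q} p≥0 q≥0 =
  subst (ℚ._≤ p ℚ.* q) (ℚ.*-zeroʳ p) (ℚ.*-monoˡ-≤-nonNeg p ⦃ ℚ.nonNegative {p} p≥0 ⦄ q≥0)

*-mono-≤-nonNeg : ∀ {p p′ q q′} → 0ℚ ℚ.≤ p′ → 0ℚ ℚ.≤ q →
                  p ℚ.≤ p′ → q ℚ.≤ q′ → p ℚ.* q ℚ.≤ p′ ℚ.* q′
*-mono-≤-nonNeg {p′ = p′} {q = q} p′≥0 q≥0 p≤p′ q≤q′ = ℚ.≤-trans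
  (ℚ.*-monoʳ-≤-nonNeg q ⦃ ℚ.nonNegative {q} q≥0 ⦄ p≤p′)
  (ℚ.*-monoˡ-≤-nonNeg p′ ⦃ ℚ.nonNegative {p′} p′≥0 ⦄ q≤q′)

p≤p+q : ∀ {p q} → 0ℚ ℚ.≤ q → p ℚ.≤ p ℚ.+ q
p≤p+q {p} {q} q≥0 = subst (ℚ._≤ p ℚ.+ q) (ℚ.+-identityʳ p) (ℚ.+-monoʳ-≤ p q≥0)

quarter : ℚ
quarter = + 1 / 4

quarterPow-nonNeg : ∀ k → 0ℚ ℚ.≤ quarterPow k
quarterPow-nonNeg zero    = from-yes (0ℚ ℚ.≤? 1ℚ)
quarterPow-nonNeg (suc k) = *-nonNeg (from-yes (0ℚ ℚ.≤? quarter)) (quarterPow-nonNeg k)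

quarterPow-+ : ∀ a b → quarterPow (a ℕ.+ b) ≡ quarterPow a ℚ.* quarterPow b
quarterPow-+ zero    b = sym (ℚ.*-identityˡ (quarterPow b))
quarterPow-+ (suc a) b =
  trans (cong (quarter ℚ.*_) (quarterPow-+ a b)) (sym (ℚ.*-assoc quarter (quarterPow a) (quarterPow b)))

sumMap : (A → ℚ) → List A → ℚ
sumMap h xs = sumℚ (map h xs)

sumℚ-++ : ∀ (xs ys : List ℚ) → sumℚ (xs ++ ys) ≡ sumℚ xs ℚ.+ sumℚ ys
sumℚ-++ []       ys = sym (ℚ.+-identityˡ _)
sumℚ-++ (x ∷ xs) ys = trans (cong (x ℚ.+_) (sumℚ-++ xs ys)) (sym (ℚ.+-assoc x (sumℚ xs) (sumℚ ys)))

sumMap-++ : ∀ (h : A → ℚ) xs ys → sumMap h (xs ++ ys) ≡ sumMap h xs ℚ.+ sumMap h ys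
sumMap-++ h xs ys = trans (cong sumℚ (map-++ h xs ys)) (sumℚ-++ (map h xs) (map h ys))

sumMap-map : ∀ (h : B → ℚ) (k : A → B) xs → sumMap h (map k xs) ≡ sumMap (h ∘ k) xs
sumMap-map h k []       = refl
sumMap-map h k (x ∷ xs) = cong (h (k x) ℚ.+_) (sumMap-map h k xs)

sumMap-cong : ∀ {h h′ : A → ℚ} xs → (∀ {x} → x ∈ xs → h x ≡ h′ x) → sumMap h xs ≡ sumMap h′ xs
sumMap-cong []       _     = refl
sumMap-cong (x ∷ xs) h≗h′ = cong₂ ℚ._+_ (h≗h′ (here refl)) (sumMap-cong xs (h≗h′ ∘ there))

sumMap-*ˡ : ∀ c (h : A → ℚ) xs → sumMap (λ x → c ℚ.* h x) xs ≡ c ℚ.* sumMap h xs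
sumMap-*ˡ c h []       = sym (ℚ.*-zeroʳ c)
sumMap-*ˡ c h (x ∷ xs) =
  trans (cong (c ℚ.* h x ℚ.+_) (sumMap-*ˡ c h xs)) (sym (ℚ.*-distribˡ-+ c (h x) (sumMap h xs)))

module _ {h : A → ℚ} (h≥0 : ∀ x → 0ℚ ℚ.≤ h x) where

  sumMap-nonNeg : ∀ xs → 0ℚ ℚ.≤ sumMap h xs
  sumMap-nonNeg []       = ℚ.≤-refl
  sumMap-nonNeg (x ∷ xs) = ℚ.+-mono-≤ (h≥0 x) (sumMap-nonNeg xs)

  sumMap-mono-⊆ : ∀ {xs ys} → Unique xs → xs ⊆ ys → sumMap h xs ℚ.≤ sumMap h ys
  sumMap-mono-⊆ {[]}     {ys} _ _ = sumMap-nonNeg ys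
  sumMap-mono-⊆ {x ∷ xs} (x∉xs ∷ xs-unique) xs⊆ys with ∈-∃++ (xs⊆ys (here refl))
  ... | ys₁ , ys₂ , refl = begin
    h x ℚ.+ sumMap h xs                     ≤⟨ ℚ.+-monoʳ-≤ (h x) (sumMap-mono-⊆ xs-unique xs⊆ys₁++ys₂) ⟩
    h x ℚ.+ sumMap h (ys₁ ++ ys₂)           ≡⟨ cong (h x ℚ.+_) (sumMap-++ h ys₁ ys₂) ⟩
    h x ℚ.+ (sumMap h ys₁ ℚ.+ sumMap h ys₂) ≡⟨ swap (h x) (sumMap h ys₁) (sumMap h ys₂) ⟩
    sumMap h ys₁ ℚ.+ (h x ℚ.+ sumMap h ys₂) ≡⟨ sumMap-++ h ys₁ (x ∷ ys₂) ⟨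
    sumMap h (ys₁ ++ x ∷ ys₂)               ∎
    where
    open ℚ.≤-Reasoning
    open +-*-Solver
    swap : ∀ a b c → a ℚ.+ (b ℚ.+ c) ≡ b ℚ.+ (a ℚ.+ c)
    swap = solve 3 (λ a b c → a :+ (b :+ c) := b :+ (a :+ c)) refl
    xs⊆ys₁++ys₂ : xs ⊆ ys₁ ++ ys₂
    xs⊆ys₁++ys₂ {y} y∈xs with ∈-++⁻ ys₁ (xs⊆ys (there y∈xs))
    ... | inj₁ y∈ys₁          = ∈-++⁺ˡ y∈ys₁
    ... | inj₂ (here refl)    = ⊥-elim (All.lookup x∉xs y∈xs refl)
    ... | inj₂ (there y∈ys₂)  = ∈-++⁺ʳ ys₁ y∈ys₂

  sumMap-≤-injection : (k : B → A) → (∀ {x y} → k x ≡ k y → x ≡ y) → ∀ {xs ys} →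
                       Unique xs → (∀ {x} → x ∈ xs → k x ∈ ys) → sumMap (h ∘ k) xs ℚ.≤ sumMap h ys
  sumMap-≤-injection k k-injective {xs} {ys} xs-unique k[xs]⊆ys = begin
    sumMap (h ∘ k) xs  ≡⟨ sumMap-map h k xs ⟨
    sumMap h (map k xs) ≤⟨ sumMap-mono-⊆ (Unique.map⁺ k-injective xs-unique) map⊆ ⟩
    sumMap h ys         ∎
    where
    open ℚ.≤-Reasoning
    map⊆ : map k xs ⊆ ys
    map⊆ y∈ with ∈-map⁻ k y∈
    ... | x , x∈xs , refl = k[xs]⊆ys x∈xs

sumMap-cartesianProductWith : (h : C → ℚ) (k : A → B → C) (u : A → ℚ) (v : B → ℚ) →
  (∀ a b → h (k a b) ≡ u a ℚ.* v b) →
  ∀ xs ys → sumMap h (cartesianProductWith k xs ys) ≡ sumMap u xs ℚ.* sumMap v ys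
sumMap-cartesianProductWith h k u v h∘k≡u*v []       ys = sym (ℚ.*-zeroˡ (sumMap v ys))
sumMap-cartesianProductWith h k u v h∘k≡u*v (x ∷ xs) ys = begin
  sumMap h (map (k x) ys ++ cartesianProductWith k xs ys)
    ≡⟨ sumMap-++ h (map (k x) ys) _ ⟩
  sumMap h (map (k x) ys) ℚ.+ sumMap h (cartesianProductWith k xs ys)
    ≡⟨ cong₂ ℚ._+_ row (sumMap-cartesianProductWith h k u v h∘k≡u*v xs ys) ⟩
  u x ℚ.* sumMap v ys ℚ.+ sumMap u xs ℚ.* sumMap v ys
    ≡⟨ ℚ.*-distribʳ-+ (sumMap v ys) (u x) (sumMap u xs) ⟨
  (u x ℚ.+ sumMap u xs) ℚ.* sumMap v ys ∎
  where
  open ≡-Reasoning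
  row : sumMap h (map (k x) ys) ≡ u x ℚ.* sumMap v ys
  row = begin
    sumMap h (map (k x) ys)            ≡⟨ sumMap-map h (k x) ys ⟩
    sumMap (h ∘ k x) ys                ≡⟨ sumMap-cong ys (λ {y} _ → h∘k≡u*v x y) ⟩
    sumMap (λ y → u x ℚ.* v y) ys      ≡⟨ sumMap-*ˡ (u x) v ys ⟩
    u x ℚ.* sumMap v ys                ∎

sumMap-∷ʳ : ∀ (h : A → ℚ) xs x → sumMap h (xs ∷ʳ x) ≡ sumMap h xs ℚ.+ h x
sumMap-∷ʳ h xs x = trans (sumMap-++ h xs (x ∷ [])) (cong (sumMap h xs ℚ.+_) (ℚ.+-identityʳ (h x)))

data Decomposition (n : ℕ) : Set where
  is-one       : n ≡ 1 → Decomposition n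
  is-double    : ∀ k → n ≡ 2 ℕ.* k → Decomposition n
  is-oddPrime* : ∀ q r → Prime q → Odd q → Odd r → n ≡ q ℕ.* r → Decomposition n

decompose : ∀ n → Decomposition n
decompose zero = is-double 0 refl
decompose (suc zero) = is-one refl
decompose n@(suc (suc _)) with 2 ∣? n
... | yes (divides k n≡k*2) = is-double k (trans n≡k*2 (ℕ.*-comm k 2))
... | no  n-odd with primeFactor n (λ ())
...   | q , r , q-prime , n≡q*r =
  is-oddPrime* q r q-prime (n-odd ∘ subst (2 ∣_) (sym n≡q*r) ∘ ∣m⇒∣m*n r)
                           (n-odd ∘ subst (2 ∣_) (sym n≡q*r) ∘ ∣n⇒∣m*n q) n≡q*r

data Label : Set where
  one       : Label
  double    : ℕ → Label
  oddPrime* : ℕ → ℕ → Label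

oddPrime*-injective : ∀ {a b c d} → oddPrime* a b ≡ oddPrime* c d → a ≡ c × b ≡ d
oddPrime*-injective refl = refl , refl

label : ∀ {n} → Decomposition n → Label
label (is-one _)                 = one
label (is-double k _)            = double k
label (is-oddPrime* q r _ _ _ _) = oddPrime* (primeCount q) r

label-injective : ∀ {m n} (d : Decomposition m) (e : Decomposition n) → label d ≡ label e → m ≡ n
label-injective (is-one m≡1)      (is-one n≡1)      _    = trans m≡1 (sym n≡1)
label-injective (is-double k m≡)  (is-double _ n≡)  refl = trans m≡ (sym n≡)
label-injective (is-oddPrime* q _ q-prime _ _ m≡) (is-oddPrime* q′ _ q′-prime _ _ n≡) eq
  with oddPrime*-injective eq
... | πq≡πq′ , refl rewrite primeCount-injective q-prime q′-prime πq≡πq′ = trans m≡ (sym n≡)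
label-injective (is-one _)               (is-double _ _)          ()
label-injective (is-one _)               (is-oddPrime* _ _ _ _ _ _) ()
label-injective (is-double _ _)          (is-one _)               ()
label-injective (is-double _ _)          (is-oddPrime* _ _ _ _ _ _) ()
label-injective (is-oddPrime* _ _ _ _ _ _) (is-one _)             ()
label-injective (is-oddPrime* _ _ _ _ _ _) (is-double _ _)        ()

labelOf : ℕ → Label
labelOf n = label (decompose n)

labelOf-injective : ∀ {m n} → labelOf m ≡ labelOf n → m ≡ n
labelOf-injective {m} {n} = label-injective (decompose m) (decompose n)

indices≥2 : ℕ → List ℕ
indices≥2 M = applyUpTo (2 ℕ.+_) (ℕ.pred M)

oddsUpTo : ℕ → List ℕ
oddsUpTo M = filter odd? (range1 M)

oddPrime*Labels : ℕ → List Label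
oddPrime*Labels M = cartesianProductWith oddPrime* (indices≥2 M) (oddsUpTo M)

labelsUpTo : ℕ → List Label
labelsUpTo M = one ∷ (map double (range1 M) ++ oddPrime*Labels M)

oddLabelsUpTo : ℕ → List Label
oddLabelsUpTo M = one ∷ oddPrime*Labels M

∈-indices≥2 : ∀ {m M} → 2 ≤ m → m ≤ M → m ∈ indices≥2 M
∈-indices≥2 {suc (suc i)} {suc M} _ (s≤s i<M) = ∈-applyUpTo⁺ (2 ℕ.+_) i<M
∈-indices≥2 {suc zero} (s≤s ())

oddPrime*∈ : ∀ {q r} M → Prime q → Odd q → Odd r → 1 ≤ q ℕ.* r → q ℕ.* r ≤ suc M →
             oddPrime* (primeCount q) r ∈ oddPrime*Labels M
oddPrime*∈ {q} {zero}  M _ _ _ 1≤q*0 _ = ⊥-elim (ℕ.<-irrefl (sym (ℕ.*-zeroʳ q)) 1≤q*0)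
oddPrime*∈ {q} {suc r} M q-prime q-odd r-odd _ q*r≤1+M =
  ∈-cartesianProductWith⁺ oddPrime* (∈-indices≥2 2≤πq πq≤M)
                                    (∈-filter⁺ odd? (∈-range1⁺ (s≤s z≤n) 1+r≤M) r-odd)
  where
  3≤q : 3 ≤ q
  3≤q = oddPrime⇒3≤ q-prime q-odd
  2≤πq : 2 ≤ primeCount q
  2≤πq = primeCount-mono-≤ 3≤q
  πq≤M : primeCount q ≤ M
  πq≤M = ℕ.s≤s⁻¹ (ℕ.≤-trans (primeCount-< (prime⇒1≤ q-prime))
                            (ℕ.≤-trans (ℕ.m≤m*n q (suc r)) q*r≤1+M))
  1+r≤M : suc r ≤ M
  1+r≤M = ℕ.s≤s⁻¹ (ℕ.≤-trans (m<n*m (suc r) (ℕ.≤-trans (ℕ.n≤1+n 2) 3≤q)) q*r≤1+M)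

label∈labelsUpTo : ∀ {n} M (d : Decomposition n) → 1 ≤ n → n ≤ suc M → label d ∈ labelsUpTo M
label∈labelsUpTo M (is-one _) _ _ = here refl
label∈labelsUpTo M (is-double (suc k) refl) _ 2k≤1+M =
  there (∈-++⁺ˡ (∈-map⁺ double (∈-range1⁺ (s≤s z≤n) 1+k≤M)))
  where
  1+k≤M : suc k ≤ M
  1+k≤M = ℕ.s≤s⁻¹ (ℕ.≤-trans (m<n*m (suc k) {2} (s≤s (s≤s z≤n))) 2k≤1+M)
label∈labelsUpTo M (is-oddPrime* q r q-prime q-odd r-odd refl) 1≤n n≤1+M =
  there (∈-++⁺ʳ (map double (range1 M)) (oddPrime*∈ M q-prime q-odd r-odd 1≤n n≤1+M))

label∈oddLabelsUpTo : ∀ {n} M (d : Decomposition n) → 1 ≤ n → n ≤ suc M → Odd n →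
                      label d ∈ oddLabelsUpTo M
label∈oddLabelsUpTo M (is-one _) _ _ _ = here refl
label∈oddLabelsUpTo M (is-double k n≡2k) _ _ n-odd = ⊥-elim (n-odd (divides k (trans n≡2k (ℕ.*-comm 2 k))))
label∈oddLabelsUpTo M (is-oddPrime* q r q-prime q-odd r-odd refl) 1≤n n≤1+M _ =
  there (oddPrime*∈ M q-prime q-odd r-odd 1≤n n≤1+M)

module GutmanIvićMatula
  (g : ℕ → ℕ)
  (g-1 : g 1 ≡ 0)
  (g-* : ∀ a b → 1 ≤ a → 1 ≤ b → g (a ℕ.* b) ≡ g a ℕ.+ g b)
  (g-prime : ∀ n q → 1 ≤ n → Prime q → primeCount q ≡ n → g q ≡ suc (g n))
  where

  term : ℕ → ℚ
  term n = quarterPow (g n)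

  term-nonNeg : ∀ n → 0ℚ ℚ.≤ term n
  term-nonNeg n = quarterPow-nonNeg (g n)

  g-prime-π : ∀ {q} → Prime q → g q ≡ suc (g (primeCount q))
  g-prime-π {q} q-prime = g-prime (primeCount q) q 1≤πq q-prime refl
    where
    1≤πq : 1 ≤ primeCount q
    1≤πq rewrite primeCount-prime q-prime = s≤s z≤n

  4*term-prime : ∀ {q} → Prime q → (+ 4 / 1) ℚ.* term q ≡ term (primeCount q)
  4*term-prime {q} q-prime = begin
    (+ 4 / 1) ℚ.* term q                            ≡⟨ cong (((+ 4 / 1) ℚ.*_) ∘ quarterPow) (g-prime-π q-prime) ⟩
    (+ 4 / 1) ℚ.* (quarter ℚ.* term (primeCount q)) ≡⟨ ℚ.*-assoc (+ 4 / 1) quarter (term (primeCount q)) ⟨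
    1ℚ ℚ.* term (primeCount q)                      ≡⟨ ℚ.*-identityˡ (term (primeCount q)) ⟩
    term (primeCount q)                             ∎
    where open ≡-Reasoning

  labelWeight : Label → ℚ
  labelWeight one             = 1ℚ
  labelWeight (double k)      = quarter ℚ.* term k
  labelWeight (oddPrime* m r) = quarter ℚ.* (term m ℚ.* term r)

  labelWeight-nonNeg : ∀ l → 0ℚ ℚ.≤ labelWeight l
  labelWeight-nonNeg one             = from-yes (0ℚ ℚ.≤? 1ℚ)
  labelWeight-nonNeg (double k)      = *-nonNeg (quarterPow-nonNeg 1) (term-nonNeg k)
  labelWeight-nonNeg (oddPrime* m r) = *-nonNeg (quarterPow-nonNeg 1) (*-nonNeg (term-nonNeg m) (term-nonNeg r))

  term≡labelWeight : ∀ {n} (d : Decomposition n) → 1 ≤ n → term n ≡ labelWeight (label d)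
  term≡labelWeight (is-one refl) _ = cong quarterPow g-1
  term≡labelWeight (is-double (suc k) refl) _ =
    cong quarterPow (trans (g-* 2 (suc k) (s≤s z≤n) (s≤s z≤n)) (cong (ℕ._+ g (suc k)) g-2))
    where
    g-2 : g 2 ≡ 1
    g-2 = trans (g-prime-π prime[2]) (cong suc g-1)
  term≡labelWeight (is-oddPrime* q (suc r) q-prime _ _ refl) _ = begin
    quarterPow (g (q ℕ.* suc r))
      ≡⟨ cong quarterPow (g-* q (suc r) (prime⇒1≤ q-prime) (s≤s z≤n)) ⟩
    quarterPow (g q ℕ.+ g (suc r))
      ≡⟨ cong (λ k → quarterPow (k ℕ.+ g (suc r))) (g-prime-π q-prime) ⟩
    quarter ℚ.* quarterPow (g (primeCount q) ℕ.+ g (suc r))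
      ≡⟨ cong (quarter ℚ.*_) (quarterPow-+ (g (primeCount q)) (g (suc r))) ⟩
    quarter ℚ.* (term (primeCount q) ℚ.* term (suc r)) ∎
    where open ≡-Reasoning
  term≡labelWeight (is-double zero refl) ()
  term≡labelWeight (is-oddPrime* q zero _ _ _ refl) 1≤q*0 = ⊥-elim (ℕ.<-irrefl (sym (ℕ.*-zeroʳ q)) 1≤q*0)

  sumMap-term-≤ : ∀ {xs ys} → Unique xs → (∀ {n} → n ∈ xs → 1 ≤ n × labelOf n ∈ ys) →
                  sumMap term xs ℚ.≤ sumMap labelWeight ys
  sumMap-term-≤ {xs} {ys} xs-unique xs-ok = begin
    sumMap term xs
      ≡⟨ sumMap-cong xs (λ n∈xs → term≡labelWeight (decompose _) (proj₁ (xs-ok n∈xs))) ⟩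
    sumMap (labelWeight ∘ labelOf) xs
      ≤⟨ sumMap-≤-injection labelWeight-nonNeg labelOf labelOf-injective xs-unique (proj₂ ∘ xs-ok) ⟩
    sumMap labelWeight ys ∎
    where open ℚ.≤-Reasoning

  partialOdd partial≥2 : ℕ → ℚ
  partialOdd M = sumMap term (oddsUpTo M)
  partial≥2  M = sumMap term (indices≥2 M)

  sumMap-oddPrime*Labels : ∀ M →
    sumMap labelWeight (oddPrime*Labels M) ≡ quarter ℚ.* (partial≥2 M ℚ.* partialOdd M)
  sumMap-oddPrime*Labels M = begin
    sumMap labelWeight (oddPrime*Labels M)
      ≡⟨ sumMap-cartesianProductWith labelWeight oddPrime* (λ m → quarter ℚ.* term m) term
           (λ m r → sym (ℚ.*-assoc quarter (term m) (term r))) (indices≥2 M) (oddsUpTo M) ⟩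
    sumMap (λ m → quarter ℚ.* term m) (indices≥2 M) ℚ.* partialOdd M
      ≡⟨ cong (ℚ._* partialOdd M) (sumMap-*ˡ quarter term (indices≥2 M)) ⟩
    quarter ℚ.* partial≥2 M ℚ.* partialOdd M
      ≡⟨ ℚ.*-assoc quarter (partial≥2 M) (partialOdd M) ⟩
    quarter ℚ.* (partial≥2 M ℚ.* partialOdd M) ∎
    where open ≡-Reasoning

  partialℕ-suc-≤ : ∀ M →
    partialℕ g (suc M) ℚ.≤ 1ℚ ℚ.+ quarter ℚ.* (partialℕ g M ℚ.+ partial≥2 M ℚ.* partialOdd M)
  partialℕ-suc-≤ M = begin
    partialℕ g (suc M)
      ≤⟨ sumMap-term-≤ (range1-unique (suc M)) ok ⟩
    1ℚ ℚ.+ sumMap labelWeight (map double (range1 M) ++ oddPrime*Labels M)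
      ≡⟨ cong (1ℚ ℚ.+_) (sumMap-++ labelWeight (map double (range1 M)) (oddPrime*Labels M)) ⟩
    1ℚ ℚ.+ (sumMap labelWeight (map double (range1 M)) ℚ.+ sumMap labelWeight (oddPrime*Labels M))
      ≡⟨ cong (1ℚ ℚ.+_) (cong₂ ℚ._+_ doubles (sumMap-oddPrime*Labels M)) ⟩
    1ℚ ℚ.+ (quarter ℚ.* partialℕ g M ℚ.+ quarter ℚ.* (partial≥2 M ℚ.* partialOdd M))
      ≡⟨ cong (1ℚ ℚ.+_) (ℚ.*-distribˡ-+ quarter (partialℕ g M) (partial≥2 M ℚ.* partialOdd M)) ⟨
    1ℚ ℚ.+ quarter ℚ.* (partialℕ g M ℚ.+ partial≥2 M ℚ.* partialOdd M) ∎
    where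
    open ℚ.≤-Reasoning
    ok : ∀ {n} → n ∈ range1 (suc M) → 1 ≤ n × labelOf n ∈ labelsUpTo M
    ok {n} n∈ with ∈-range1⁻ (suc M) n∈
    ... | 1≤n , n≤1+M = 1≤n , label∈labelsUpTo M (decompose n) 1≤n n≤1+M
    doubles : sumMap labelWeight (map double (range1 M)) ≡ quarter ℚ.* partialℕ g M
    doubles = trans (sumMap-map labelWeight double (range1 M)) (sumMap-*ˡ quarter term (range1 M))

  partialOdd-suc-≤ : ∀ M → partialOdd (suc M) ℚ.≤ 1ℚ ℚ.+ quarter ℚ.* (partial≥2 M ℚ.* partialOdd M)
  partialOdd-suc-≤ M = begin
    partialOdd (suc M)                   ≤⟨ sumMap-term-≤ (Unique.filter⁺ odd? (range1-unique (suc M))) ok ⟩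
    sumMap labelWeight (oddLabelsUpTo M) ≡⟨ cong (1ℚ ℚ.+_) (sumMap-oddPrime*Labels M) ⟩
    1ℚ ℚ.+ quarter ℚ.* (partial≥2 M ℚ.* partialOdd M) ∎
    where
    open ℚ.≤-Reasoning
    ok : ∀ {n} → n ∈ oddsUpTo (suc M) → 1 ≤ n × labelOf n ∈ oddLabelsUpTo M
    ok {n} n∈ with ∈-filter⁻ odd? {xs = range1 (suc M)} n∈
    ... | n∈range , n-odd with ∈-range1⁻ (suc M) n∈range
    ...   | 1≤n , n≤1+M = 1≤n , label∈oddLabelsUpTo M (decompose n) 1≤n n≤1+M n-odd

  partialℕ-suc≡1+partial≥2 : ∀ M → partialℕ g (suc M) ≡ 1ℚ ℚ.+ partial≥2 (suc M)
  partialℕ-suc≡1+partial≥2 M = trans (cong (sumMap term) (range1≡applyUpTo (suc M)))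
                                     (cong (λ k → quarterPow k ℚ.+ partial≥2 (suc M)) g-1)

  partial≥2-≤ : ∀ M → partialℕ g M ℚ.≤ (+ 7 / 4) → partial≥2 M ℚ.≤ (+ 3 / 4)
  partial≥2-≤ zero    _         = from-yes (0ℚ ℚ.≤? (+ 3 / 4))
  partial≥2-≤ (suc M) S≤7/4 = begin
    partial≥2 (suc M)                      ≡⟨ solve 1 (λ a → a := con (ℚ.- 1ℚ) :+ (con 1ℚ :+ a)) refl _ ⟩
    ℚ.- 1ℚ ℚ.+ (1ℚ ℚ.+ partial≥2 (suc M)) ≡⟨ cong (ℚ.- 1ℚ ℚ.+_) (partialℕ-suc≡1+partial≥2 M) ⟨
    ℚ.- 1ℚ ℚ.+ partialℕ g (suc M)         ≤⟨ ℚ.+-monoʳ-≤ (ℚ.- 1ℚ) S≤7/4 ⟩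
    ℚ.- 1ℚ ℚ.+ (+ 7 / 4)                     ≡⟨⟩
    (+ 3 / 4)                                ∎
    where
    open ℚ.≤-Reasoning
    open +-*-Solver

  -- The constants close the induction: 1 + (7/4 + (3/4)(5/4))/4 = 107/64 ≤ 7/4 and 1 + (3/4)(5/4)/4 = 79/64 ≤ 5/4.
  partialℕ≤7/4×partialOdd≤5/4 : ∀ N → partialℕ g N ℚ.≤ (+ 7 / 4) × partialOdd N ℚ.≤ (+ 5 / 4)
  partialℕ≤7/4×partialOdd≤5/4 zero    = from-yes (0ℚ ℚ.≤? (+ 7 / 4)) , from-yes (0ℚ ℚ.≤? (+ 5 / 4))
  partialℕ≤7/4×partialOdd≤5/4 (suc M) with partialℕ≤7/4×partialOdd≤5/4 M
  ... | S≤7/4 , O≤5/4 =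
    ℚ.≤-trans (partialℕ-suc-≤ M)
      (ℚ.≤-trans (1+quarter*-mono (ℚ.+-mono-≤ S≤7/4 AO≤))
        (from-yes (1ℚ ℚ.+ quarter ℚ.* ((+ 7 / 4) ℚ.+ (+ 3 / 4) ℚ.* (+ 5 / 4)) ℚ.≤? (+ 7 / 4)))) ,
    ℚ.≤-trans (partialOdd-suc-≤ M)
      (ℚ.≤-trans (1+quarter*-mono AO≤)
        (from-yes (1ℚ ℚ.+ quarter ℚ.* ((+ 3 / 4) ℚ.* (+ 5 / 4)) ℚ.≤? (+ 5 / 4))))
    where
    1+quarter*-mono : ∀ {p q} → p ℚ.≤ q → 1ℚ ℚ.+ quarter ℚ.* p ℚ.≤ 1ℚ ℚ.+ quarter ℚ.* q
    1+quarter*-mono = ℚ.+-monoʳ-≤ 1ℚ ∘ ℚ.*-monoˡ-≤-nonNeg quarter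
    AO≤ : partial≥2 M ℚ.* partialOdd M ℚ.≤ (+ 3 / 4) ℚ.* (+ 5 / 4)
    AO≤ = *-mono-≤-nonNeg (from-yes (0ℚ ℚ.≤? (+ 3 / 4))) (sumMap-nonNeg term-nonNeg (oddsUpTo M))
            (partial≥2-≤ M S≤7/4) O≤5/4

  partialℕ-mono : ∀ {m n} → m ≤ n → partialℕ g m ℚ.≤ partialℕ g n
  partialℕ-mono {m} m≤n = sumMap-mono-⊆ term-nonNeg (range1-unique m) (range1-⊆ m≤n)

  4*partialℙ≡partialℕ∘primeCount : ∀ K → (+ 4 / 1) ℚ.* partialℙ g K ≡ partialℕ g (primeCount K)
  4*partialℙ≡partialℕ∘primeCount zero = refl
  4*partialℙ≡partialℕ∘primeCount (suc K) with prime? (suc K)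
  ... | yes p = begin
    (+ 4 / 1) ℚ.* sumMap term (filter prime? (range1 K ∷ʳ suc K))
      ≡⟨ cong (λ xs → (+ 4 / 1) ℚ.* sumMap term xs) (filter-∷ʳ-accept prime? (range1 K) p) ⟩
    (+ 4 / 1) ℚ.* sumMap term (filter prime? (range1 K) ∷ʳ suc K)
      ≡⟨ cong ((+ 4 / 1) ℚ.*_) (sumMap-∷ʳ term (filter prime? (range1 K)) (suc K)) ⟩
    (+ 4 / 1) ℚ.* (partialℙ g K ℚ.+ term (suc K))
      ≡⟨ ℚ.*-distribˡ-+ (+ 4 / 1) (partialℙ g K) (term (suc K)) ⟩
    (+ 4 / 1) ℚ.* partialℙ g K ℚ.+ (+ 4 / 1) ℚ.* term (suc K)
      ≡⟨ cong₂ ℚ._+_ (4*partialℙ≡partialℕ∘primeCount K) (4*term-prime p) ⟩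
    partialℕ g (primeCount K) ℚ.+ term (primeCount (suc K))
      ≡⟨ cong (λ n → partialℕ g (primeCount K) ℚ.+ term n) (primeCount-suc-prime K p) ⟩
    partialℕ g (primeCount K) ℚ.+ term (suc (primeCount K))
      ≡⟨ sumMap-∷ʳ term (range1 (primeCount K)) (suc (primeCount K)) ⟨
    partialℕ g (suc (primeCount K))
      ≡⟨ cong (partialℕ g) (primeCount-suc-prime K p) ⟨
    partialℕ g (primeCount (suc K)) ∎
    where open ≡-Reasoning
  ... | no ¬p = begin
    (+ 4 / 1) ℚ.* sumMap term (filter prime? (range1 K ∷ʳ suc K))
      ≡⟨ cong (λ xs → (+ 4 / 1) ℚ.* sumMap term xs) (filter-∷ʳ-reject prime? (range1 K) ¬p) ⟩
    (+ 4 / 1) ℚ.* partialℙ g K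
      ≡⟨ 4*partialℙ≡partialℕ∘primeCount K ⟩
    partialℕ g (primeCount K)
      ≡⟨ cong (partialℕ g) (primeCount-suc-nonprime K ¬p) ⟨
    partialℕ g (primeCount (suc K)) ∎
    where open ≡-Reasoning

  partialℕ-sameSup-4*partialℙ : SameSup (partialℕ g) (λ K → (+ 4 / 1) ℚ.* partialℙ g K)
  partialℕ-sameSup-4*partialℙ = partialℕ-below , partialℙ-below
    where
    partialℕ-below : ∀ N ε → 0ℚ ℚ.< ε →
                     ∃ λ K → partialℕ g N ℚ.≤ (+ 4 / 1) ℚ.* partialℙ g K ℚ.+ ε
    partialℕ-below N ε ε>0 with primeCount-unbounded N
    ... | K , N≤πK = K , (begin
      partialℕ g N                     ≤⟨ partialℕ-mono N≤πK ⟩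
      partialℕ g (primeCount K)        ≡⟨ 4*partialℙ≡partialℕ∘primeCount K ⟨
      (+ 4 / 1) ℚ.* partialℙ g K       ≤⟨ p≤p+q (ℚ.<⇒≤ ε>0) ⟩
      (+ 4 / 1) ℚ.* partialℙ g K ℚ.+ ε ∎)
      where open ℚ.≤-Reasoning
    partialℙ-below : ∀ N ε → 0ℚ ℚ.< ε →
                     ∃ λ K → (+ 4 / 1) ℚ.* partialℙ g N ℚ.≤ partialℕ g K ℚ.+ ε
    partialℙ-below N ε ε>0 = primeCount N ,
      ℚ.≤-trans (ℚ.≤-reflexive (4*partialℙ≡partialℕ∘primeCount N)) (p≤p+q (ℚ.<⇒≤ ε>0))

mainTheorem2 : (g : ℕ → ℕ)
    → g 1 ≡ 0
    → (∀ a b → 1 ≤ a → 1 ≤ b → g (a Data.Nat.* b) ≡ g a Data.Nat.+ g b)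
    → (∀ n q → 1 ≤ n → Prime q → primeCount q ≡ n → g q ≡ suc (g n))
    → SameSup (partialℕ g) (λ K → (+ 4 / 1) * partialℙ g K)
      × (∃ λ (M : ℚ) → (M < + 2 / 1) × (∀ N → partialℕ g N Data.Rational.≤ M))
mainTheorem2 g g-1 g-* g-prime =
  partialℕ-sameSup-4*partialℙ ,
  + 7 / 4 , from-yes (+ 7 / 4 ℚ.<? + 2 / 1) , proj₁ ∘ partialℕ≤7/4×partialOdd≤5/4
  where open GutmanIvićMatula g g-1 g-* g-prime
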